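{- Let $\{P_n\}_{n\ge 0}$ be defined by $P_0=1$, $P_1=8$ and, for $n\ge 2$, $$n^2 P_n = 8(3n^2-3n+1)P_{n-1} - 128(n-1)^2 P_{n-2}.$$ For $n\ge 1$ let $l(n) = \dfrac{24(3n^2-3n+1)}{5n^2}$ and $\ell(n) = \dfrac{16(n^3-n^2-1)}{n^3}$. Then for all integers $n\ge 6$, $$l(n) < \frac{P_n}{P_{n-1}} < \ell(n).$$ -}

module Defs where

open import Data.Nat using (ℕ; zero; suc)
import Data.Integer as ℤ
open import Data.Nat.Properties using (m*n≢0)
open import Data.Rational using (ℚ; _+_; _*_; _-_; _/_; _÷_; 1/_; NonZero)

ι : ℕ → ℚ
ι n = ℤ.+ n / 1

P : ℕ → ℚ
P zero = ι 1
P (suc zero) = ι 8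
P (suc (suc k)) =
  (ι 8 * (ι 3 * n * n - ι 3 * n + ι 1) * P (suc k)
    - ι 128 * (n - ι 1) * (n - ι 1) * P k)
  * (ℤ.+ 1 / (suc (suc k) Data.Nat.* suc (suc k)))
  where
  import Data.Nat
  n : ℚ
  n = ι (suc (suc k))

l : (n : ℕ) → .{{_ : Data.Nat.NonZero n}} → ℚ
l n = (ι 24 * (ι 3 * ι n * ι n - ι 3 * ι n + ι 1))
        * ((ℤ.+ 1 / (5 Data.Nat.* (n Data.Nat.* n)))
             {{m*n≢0 5 (n Data.Nat.* n) {{_}} {{m*n≢0 n n}}}})
  where import Data.Nat

ℓ : (n : ℕ) → .{{_ : Data.Nat.NonZero n}} → ℚ
ℓ n {{nz}} = (ι 16 * (ι n * ι n * ι n - ι n * ι n - ι 1))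
        * ((ℤ.+ 1 / (n Data.Nat.* (n Data.Nat.* n)))
             {{m*n≢0 n (n Data.Nat.* n) {{nz}} {{m*n≢0 n n}}}})
  where import Data.Nat

-- For n ≥ 6 put Lₙ = 5n²Pₙ - 24A(n)Pₙ₋₁ and Uₙ = 16B(n)Pₙ₋₁ - n³Pₙ, with A(n) = 3n²-3n+1 and
-- B(n) = n³-n²-1, so that the claim is Pₙ₋₁ > 0, Lₙ > 0, Uₙ > 0. Substituting the recurrence,
--   5n² Lₙ₊₁ = 16A(n+1) Lₙ + K(n-6) Pₙ₋₁   and   n³ Uₙ₊₁ = C(n-6) Uₙ + M(n-6) Pₙ₋₁
-- with polynomials K, C, M having nonnegative coefficients, so all three inequalities propagate
-- from n = 6, where they are checked by computation.
module Submission where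

open import Defs
open import Data.Nat using (ℕ; zero; suc; _+_)
open import Data.Product using (Σ; _×_)
open import Data.Rational using (_<_; _÷_; NonZero)

import Data.Nat as ℕ
open import Data.Nat.Properties using (m*n≢0)
open import Data.Nat.Coprimality using (1-coprimeTo) renaming (sym to coprime-sym)
import Data.Integer as ℤ
import Data.Integer.Properties as ℤ
open import Data.List using (List; []; _∷_)
open import Data.Product using (_,_; proj₁; proj₂)
open import Data.Rational
  using (ℚ; mkℚ; 0ℚ; 1ℚ; _≤_; _*_; _-_; 1/_; _/_; positive; nonNegative; _<?_)
  renaming (_+_ to _⊕_)
open import Data.Rational.Properties
open import Data.Rational.Solver using (module +-*-Solver)
open import Data.Unit using (tt)
open import Relation.Binary.PropositionalEquality
open import Relation.Nullary.Decidable using (toWitness)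
open ≡-Reasoning

ι-mkℚ : ∀ n → ι n ≡ mkℚ (ℤ.+ n) 0 (coprime-sym (1-coprimeTo n))
ι-mkℚ n = normalize-coprime (coprime-sym (1-coprimeTo n))

ι-homo-+ : ∀ a b → ι (a + b) ≡ ι a ⊕ ι b
ι-homo-+ a b rewrite ι-mkℚ a | ι-mkℚ b =
  cong (_/ 1) (trans (ℤ.pos-+ a b)
    (sym (cong₂ ℤ._+_ (ℤ.*-identityʳ (ℤ.+ a)) (ℤ.*-identityʳ (ℤ.+ b)))))

ι-homo-* : ∀ a b → ι (a ℕ.* b) ≡ ι a * ι b
ι-homo-* a b rewrite ι-mkℚ a | ι-mkℚ b = cong (_/ 1) (ℤ.pos-* a b)

p*1/n*n≡p : ∀ p n .{{_ : ℕ.NonZero n}} → p * (ℤ.+ 1 / n) * ι n ≡ p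
p*1/n*n≡p p n@(suc k) = begin
  p * (ℤ.+ 1 / n) * ι n ≡⟨ *-assoc p _ (ι n) ⟩
  p * ((ℤ.+ 1 / n) * ι n) ≡⟨ cong (p *_) (cong₂ _*_ 1/n≡1/ιn (ι-mkℚ n)) ⟩
  p * (1/ ιn * ιn)      ≡⟨ cong (p *_) (*-inverseˡ ιn) ⟩
  p * 1ℚ                ≡⟨ *-identityʳ p ⟩
  p                     ∎
  where
  ιn = mkℚ (ℤ.+ n) 0 (coprime-sym (1-coprimeTo n))
  1/n≡1/ιn : ℤ.+ 1 / n ≡ 1/ ιn
  1/n≡1/ιn = normalize-coprime (1-coprimeTo n)

ι-nonNeg : ∀ n → 0ℚ ≤ ι n
ι-nonNeg n = nonNegative⁻¹ (ι n) {{normalize-nonNeg n 1}}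

ι-pos : ∀ n .{{_ : ℕ.NonZero n}} → 0ℚ < ι n
ι-pos n = positive⁻¹ (ι n) {{normalize-pos n 1}}

*-pos : ∀ {a b} → 0ℚ < a → 0ℚ < b → 0ℚ < a * b
*-pos {a} {b} 0<a 0<b = positive⁻¹ (a * b) {{pos*pos⇒pos a {{positive 0<a}} b {{positive 0<b}}}}

*-nonNeg : ∀ {a b} → 0ℚ ≤ a → 0ℚ ≤ b → 0ℚ ≤ a * b
*-nonNeg {a} {b} 0≤a 0≤b =
  nonNegative⁻¹ (a * b) {{nonNeg*nonNeg⇒nonNeg a {{nonNegative 0≤a}} b {{nonNegative 0≤b}}}}

+-pos-nonNeg : ∀ {a b} → 0ℚ < a → 0ℚ ≤ b → 0ℚ < a ⊕ b
+-pos-nonNeg {a} {b} 0<a 0≤b = subst (_< a ⊕ b) (+-identityˡ 0ℚ) (+-mono-<-≤ 0<a 0≤b)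

+-nonNeg : ∀ {a b} → 0ℚ ≤ a → 0ℚ ≤ b → 0ℚ ≤ a ⊕ b
+-nonNeg {a} {b} 0≤a 0≤b = subst (_≤ a ⊕ b) (+-identityˡ 0ℚ) (+-mono-≤ 0≤a 0≤b)

*-cancelˡ-pos : ∀ {c t} → 0ℚ < c → 0ℚ < c * t → 0ℚ < t
*-cancelˡ-pos {c} {t} 0<c 0<ct =
  *-cancelˡ-<-nonNeg c {{pos⇒nonNeg c {{positive 0<c}}}} (subst (_< c * t) (sym (*-zeroʳ c)) 0<ct)

0<q-p⇒p<q : ∀ {p q} → 0ℚ < q - p → p < q
0<q-p⇒p<q {p} {q} 0<q-p = subst₂ _<_ (+-identityˡ p) q-p+p≡q (+-monoˡ-< p 0<q-p)
  where
  open +-*-Solver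
  q-p+p≡q : q - p ⊕ p ≡ q
  q-p+p≡q = solve 2 (λ p q → q :- p :+ p := q) refl p q

gap⇒<÷ : ∀ {a c d} q p .{{_ : NonZero p}} → 0ℚ < c → 0ℚ < p → a * c ≡ d →
         0ℚ < c * q - d * p → a < q ÷ p
gap⇒<÷ {a} {c} {d} q p 0<c 0<p ac≡d 0<gap =
  0<q-p⇒p<q (*-cancelˡ-pos (*-pos 0<c 0<p) (subst (0ℚ <_) (sym cp[q/p-a]≡gap) 0<gap))
  where
  open +-*-Solver
  cp[q/p-a]≡gap : (c * p) * (q ÷ p - a) ≡ c * q - d * p
  cp[q/p-a]≡gap = begin
    (c * p) * (q * 1/ p - a)          ≡⟨ solve 5 (λ c p q p⁻¹ a → (c :* p) :* (q :* p⁻¹ :- a)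
                                            := c :* q :* (p⁻¹ :* p) :- (a :* c) :* p) refl c p q (1/ p) a ⟩
    c * q * (1/ p * p) - (a * c) * p  ≡⟨ cong₂ (λ u v → c * q * u - v * p) (*-inverseˡ p) ac≡d ⟩
    c * q * 1ℚ - d * p                ≡⟨ cong (_- d * p) (*-identityʳ (c * q)) ⟩
    c * q - d * p                     ∎

gap⇒÷< : ∀ {a c d} q p .{{_ : NonZero p}} → 0ℚ < c → 0ℚ < p → a * c ≡ d →
         0ℚ < d * p - c * q → q ÷ p < a
gap⇒÷< {a} {c} {d} q p 0<c 0<p ac≡d 0<gap =
  0<q-p⇒p<q (*-cancelˡ-pos (*-pos 0<c 0<p) (subst (0ℚ <_) (sym cp[a-q/p]≡gap) 0<gap))
  where
  open +-*-Solver
  cp[a-q/p]≡gap : (c * p) * (a - q ÷ p) ≡ d * p - c * q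
  cp[a-q/p]≡gap = begin
    (c * p) * (a - q * 1/ p)          ≡⟨ solve 5 (λ c p q p⁻¹ a → (c :* p) :* (a :- q :* p⁻¹)
                                            := (a :* c) :* p :- c :* q :* (p⁻¹ :* p)) refl c p q (1/ p) a ⟩
    (a * c) * p - c * q * (1/ p * p)  ≡⟨ cong₂ (λ u v → v * p - c * q * u) (*-inverseˡ p) ac≡d ⟩
    d * p - c * q * 1ℚ                ≡⟨ cong (d * p -_) (*-identityʳ (c * q)) ⟩
    d * p - c * q                     ∎

horner : List ℕ → ℚ → ℚ
horner []       y = 0ℚ
horner (c ∷ cs) y = ι c ⊕ y * horner cs y

horner-nonNeg : ∀ cs {y} → 0ℚ ≤ y → 0ℚ ≤ horner cs y
horner-nonNeg []       0≤y = ≤-refl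
horner-nonNeg (c ∷ cs) 0≤y = +-nonNeg (ι-nonNeg c) (*-nonNeg 0≤y (horner-nonNeg cs 0≤y))

horner-pos : ∀ c cs .{{_ : ℕ.NonZero c}} {y} → 0ℚ ≤ y → 0ℚ < horner (c ∷ cs) y
horner-pos c cs 0≤y = +-pos-nonNeg (ι-pos c) (*-nonNeg 0≤y (horner-nonNeg cs 0≤y))

-- A, B and the right-hand side of the recurrence are written exactly as in the definitions of
-- P, l and ℓ, so that they agree with them definitionally.
A B : ℚ → ℚ
A x = ι 3 * x * x - ι 3 * x ⊕ ι 1
B x = x * x * x - x * x - ι 1

recurrence : ℚ → ℚ → ℚ → ℚ
recurrence n q p = ι 8 * A n * q - ι 128 * (n - ι 1) * (n - ι 1) * p

lowerGap upperGap : ℚ → ℚ → ℚ → ℚ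
lowerGap x p q = ι 5 * x * x * q - ι 24 * A x * p
upperGap x p q = ι 16 * B x * p - x * x * x * q

Bounds : ℚ → ℚ → ℚ → Set
Bounds x p q = 0ℚ < p × 0ℚ < lowerGap x p q × 0ℚ < upperGap x p q

P-recurrence : ∀ k → let n = ι (2 + k) in P (2 + k) * (n * n) ≡ recurrence n (P (1 + k)) (P k)
P-recurrence k = trans (cong (P (2 + k) *_) (sym (ι-homo-* (2 + k) (2 + k))))
                       (p*1/n*n≡p (recurrence (ι (2 + k)) (P (1 + k)) (P k)) ((2 + k) ℕ.* (2 + k)))

module Polynomials where
  open +-*-Solver public

  c : ∀ {m} → ℕ → Polynomial m
  c k = con (ι k)

  Aˢ Bˢ : ∀ {m} → Polynomial m → Polynomial m
  Aˢ x = c 3 :* x :* x :- c 3 :* x :+ c 1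
  Bˢ x = x :* x :* x :- x :* x :- c 1

  recurrenceˢ : ∀ {m} → Polynomial m → Polynomial m → Polynomial m → Polynomial m
  recurrenceˢ n q p = c 8 :* Aˢ n :* q :- c 128 :* (n :- c 1) :* (n :- c 1) :* p

  lowerGapˢ upperGapˢ : ∀ {m} → Polynomial m → Polynomial m → Polynomial m → Polynomial m
  lowerGapˢ x p q = c 5 :* x :* x :* q :- c 24 :* Aˢ x :* p
  upperGapˢ x p q = c 16 :* Bˢ x :* p :- x :* x :* x :* q

  hornerˢ : ∀ {m} → List ℕ → Polynomial m → Polynomial m
  hornerˢ []       y = con 0ℚ
  hornerˢ (k ∷ ks) y = c k :+ y :* hornerˢ ks y

lowerRemainder upperFactor upperRemainder : List ℕ
lowerRemainder = 290688 ∷ 207360 ∷ 54144 ∷ 6144 ∷ 256 ∷ []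
upperFactor    = 2424 ∷ 1072 ∷ 160 ∷ 8 ∷ []
upperRemainder = 24960 ∷ 7936 ∷ 640 ∷ []

module _ (y : ℚ) where
  open Polynomials

  private
    x n : ℚ
    x = ι 6 ⊕ y
    n = ι 7 ⊕ y

  A-horner : A x ≡ horner (91 ∷ 33 ∷ 3 ∷ []) y
  A-horner = solve 1 (λ y → Aˢ (c 6 :+ y) := hornerˢ (91 ∷ 33 ∷ 3 ∷ []) y) refl y

  A-horner-succ : A n ≡ horner (127 ∷ 39 ∷ 3 ∷ []) y
  A-horner-succ = solve 1 (λ y → Aˢ (c 7 :+ y) := hornerˢ (127 ∷ 39 ∷ 3 ∷ []) y) refl y

  lowerGap-succ : ∀ p q r → r * (n * n) ≡ recurrence n q p →
    ι 5 * x * x * lowerGap n q r ≡ ι 16 * A n * lowerGap x p q ⊕ horner lowerRemainder y * p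
  lowerGap-succ p q r r-rec = begin
    ι 5 * x * x * lowerGap n q r
      ≡⟨ solve 3 (λ y q r → let x = c 6 :+ y ; n = c 7 :+ y in
           c 5 :* x :* x :* lowerGapˢ n q r
             := c 5 :* x :* x :* (c 5 :* (r :* (n :* n)) :- c 24 :* Aˢ n :* q)) refl y q r ⟩
    ι 5 * x * x * (ι 5 * (r * (n * n)) - ι 24 * A n * q)
      ≡⟨ cong (λ z → ι 5 * x * x * (ι 5 * z - ι 24 * A n * q)) r-rec ⟩
    ι 5 * x * x * (ι 5 * recurrence n q p - ι 24 * A n * q)
      ≡⟨ solve 3 (λ y p q → let x = c 6 :+ y ; n = c 7 :+ y in
           c 5 :* x :* x :* (c 5 :* recurrenceˢ n q p :- c 24 :* Aˢ n :* q)
             := c 16 :* Aˢ n :* lowerGapˢ x p q :+ hornerˢ lowerRemainder y :* p) refl y p q ⟩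
    ι 16 * A n * lowerGap x p q ⊕ horner lowerRemainder y * p ∎

  upperGap-succ : ∀ p q r → r * (n * n) ≡ recurrence n q p →
    x * x * x * upperGap n q r ≡ horner upperFactor y * upperGap x p q ⊕ horner upperRemainder y * p
  upperGap-succ p q r r-rec = begin
    x * x * x * upperGap n q r
      ≡⟨ solve 3 (λ y q r → let x = c 6 :+ y ; n = c 7 :+ y in
           x :* x :* x :* upperGapˢ n q r
             := x :* x :* x :* (c 16 :* Bˢ n :* q :- n :* (r :* (n :* n)))) refl y q r ⟩
    x * x * x * (ι 16 * B n * q - n * (r * (n * n)))
      ≡⟨ cong (λ z → x * x * x * (ι 16 * B n * q - n * z)) r-rec ⟩
    x * x * x * (ι 16 * B n * q - n * recurrence n q p)
      ≡⟨ solve 3 (λ y p q → let x = c 6 :+ y ; n = c 7 :+ y in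
           x :* x :* x :* (c 16 :* Bˢ n :* q :- n :* recurrenceˢ n q p)
             := hornerˢ upperFactor y :* upperGapˢ x p q :+ hornerˢ upperRemainder y :* p) refl y p q ⟩
    horner upperFactor y * upperGap x p q ⊕ horner upperRemainder y * p ∎

  bounds-step : ∀ p q r → 0ℚ ≤ y → r * (n * n) ≡ recurrence n q p → Bounds x p q → Bounds n q r
  bounds-step p q r 0≤y r-rec (0<p , 0<lowerGap , 0<upperGap) =
    0<q , 0<lowerGap-succ , 0<upperGap-succ
    where
    0<x : 0ℚ < x
    0<x = +-pos-nonNeg (ι-pos 6) 0≤y

    0<5x² : 0ℚ < ι 5 * x * x
    0<5x² = *-pos (*-pos (ι-pos 5) 0<x) 0<x

    0<24Ap : 0ℚ < ι 24 * A x * p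
    0<24Ap = *-pos (*-pos (ι-pos 24) 0<Ax) 0<p
      where
      0<Ax : 0ℚ < A x
      0<Ax = subst (0ℚ <_) (sym A-horner) (horner-pos 91 (33 ∷ 3 ∷ []) 0≤y)

    0<q : 0ℚ < q
    0<q = *-cancelˡ-pos 0<5x² (<-trans 0<24Ap (0<q-p⇒p<q 0<lowerGap))

    0<lowerGap-succ : 0ℚ < lowerGap n q r
    0<lowerGap-succ = *-cancelˡ-pos 0<5x² (subst (0ℚ <_) (sym (lowerGap-succ p q r r-rec))
      (+-pos-nonNeg (*-pos (*-pos (ι-pos 16) 0<An) 0<lowerGap)
                    (*-nonNeg (horner-nonNeg lowerRemainder 0≤y) (<⇒≤ 0<p))))
      where
      0<An : 0ℚ < A n
      0<An = subst (0ℚ <_) (sym A-horner-succ) (horner-pos 127 (39 ∷ 3 ∷ []) 0≤y)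

    0<upperGap-succ : 0ℚ < upperGap n q r
    0<upperGap-succ = *-cancelˡ-pos (*-pos (*-pos 0<x 0<x) 0<x)
      (subst (0ℚ <_) (sym (upperGap-succ p q r r-rec))
        (+-pos-nonNeg (*-pos (horner-pos 2424 (1072 ∷ 160 ∷ 8 ∷ []) 0≤y) 0<upperGap)
                      (*-nonNeg (horner-nonNeg upperRemainder 0≤y) (<⇒≤ 0<p))))

bounds-P : ∀ m → Bounds (ι (6 + m)) (P (5 + m)) (P (6 + m))
bounds-P zero    = toWitness {a? = 0ℚ <? P 5} tt
                 , toWitness {a? = 0ℚ <? lowerGap (ι 6) (P 5) (P 6)} tt
                 , toWitness {a? = 0ℚ <? upperGap (ι 6) (P 5) (P 6)} tt
bounds-P (suc m) = subst (λ n → Bounds n (P (6 + m)) (P (7 + m))) (sym (ι-homo-+ 7 m))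
  (bounds-step (ι m) (P (5 + m)) (P (6 + m)) (P (7 + m)) (ι-nonNeg m) recurrence-at-7+m
    (subst (λ x → Bounds x (P (5 + m)) (P (6 + m))) (ι-homo-+ 6 m) (bounds-P m)))
  where
  recurrence-at-7+m : P (7 + m) * ((ι 7 ⊕ ι m) * (ι 7 ⊕ ι m))
                        ≡ recurrence (ι 7 ⊕ ι m) (P (6 + m)) (P (5 + m))
  recurrence-at-7+m = subst (λ n → P (7 + m) * (n * n) ≡ recurrence n (P (6 + m)) (P (5 + m)))
                        (ι-homo-+ 7 m) (P-recurrence (5 + m))

l-cross : ∀ n .{{_ : ℕ.NonZero n}} → l n * (ι 5 * ι n * ι n) ≡ ι 24 * A (ι n)
l-cross n {{n≢0}} = begin
  l n * (ι 5 * ι n * ι n)     ≡⟨ cong (l n *_) (*-assoc (ι 5) (ι n) (ι n)) ⟩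
  l n * (ι 5 * (ι n * ι n))   ≡⟨ cong (λ z → l n * (ι 5 * z)) (ι-homo-* n n) ⟨
  l n * (ι 5 * ι (n ℕ.* n))   ≡⟨ cong (l n *_) (ι-homo-* 5 (n ℕ.* n)) ⟨
  l n * ι (5 ℕ.* (n ℕ.* n))   ≡⟨ p*1/n*n≡p (ι 24 * A (ι n)) (5 ℕ.* (n ℕ.* n))
                                   {{m*n≢0 5 (n ℕ.* n) {{_}} {{n²≢0}}}} ⟩
  ι 24 * A (ι n)              ∎
  where n²≢0 = m*n≢0 n n {{n≢0}} {{n≢0}}

ℓ-cross : ∀ n .{{_ : ℕ.NonZero n}} → ℓ n * (ι n * ι n * ι n) ≡ ι 16 * B (ι n)
ℓ-cross n {{n≢0}} = begin
  ℓ n * (ι n * ι n * ι n)     ≡⟨ cong (ℓ n *_) (*-assoc (ι n) (ι n) (ι n)) ⟩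
  ℓ n * (ι n * (ι n * ι n))   ≡⟨ cong (λ z → ℓ n * (ι n * z)) (ι-homo-* n n) ⟨
  ℓ n * (ι n * ι (n ℕ.* n))   ≡⟨ cong (ℓ n *_) (ι-homo-* n (n ℕ.* n)) ⟨
  ℓ n * ι (n ℕ.* (n ℕ.* n))   ≡⟨ p*1/n*n≡p (ι 16 * B (ι n)) (n ℕ.* (n ℕ.* n))
                                   {{m*n≢0 n (n ℕ.* n) {{n≢0}} {{n²≢0}}}} ⟩
  ι 16 * B (ι n)              ∎
  where n²≢0 = m*n≢0 n n {{n≢0}} {{n≢0}}

lemma2p2 : (m : ℕ) →
    Σ (NonZero (P (5 + m))) λ nz →
      (l (6 + m) < (P (6 + m) ÷ P (5 + m)) {{nz}})
      × ((P (6 + m) ÷ P (5 + m)) {{nz}} < ℓ (6 + m))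
lemma2p2 m =
  P≢0 , gap⇒<÷ (P (6 + m)) (P (5 + m)) {{P≢0}} 0<5n² 0<P (l-cross n) 0<lowerGap
      , gap⇒÷< (P (6 + m)) (P (5 + m)) {{P≢0}} 0<n³ 0<P (ℓ-cross n) 0<upperGap
  where
  n = 6 + m
  bounds = bounds-P m
  0<P = proj₁ bounds
  0<lowerGap = proj₁ (proj₂ bounds)
  0<upperGap = proj₂ (proj₂ bounds)
  P≢0 = pos⇒nonZero (P (5 + m)) {{positive 0<P}}
  0<n : 0ℚ < ι n
  0<n = ι-pos n
  0<5n² : 0ℚ < ι 5 * ι n * ι n
  0<5n² = *-pos (*-pos (ι-pos 5) 0<n) 0<n
  0<n³ : 0ℚ < ι n * ι n * ι n
  0<n³ = *-pos (*-pos 0<n 0<n) 0<n
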